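{- Let $\mathcal{P}$ be a finite poset and, for each $x\in\mathcal{P}$, let $k(x)\ge 1$ be an integer. Let $\mathcal{P}'$ be the poset with ground set $\{x_i : x\in\mathcal{P},\ 1\le i\le k(x)\}$ and order $x_i<y_j$ iff either $x=y$ and $i<j$, or $x<y$ in $\mathcal{P}$ (so each $x$ is replaced by the chain $x_1<\dots<x_{k(x)}$, which is a module). Then the map sending a pair $(x,y)$ of elements of $\mathcal{P}$ to the pair $(x_1,y_{k(y)})$ of elements of $\mathcal{P}'$ restricts to a bijection between the critical pairs of $\mathcal{P}$ and the critical pairs of $\mathcal{P}'$.
   Context: For an element $u$ of a poset let $\downarrow u$ (resp. $\uparrow u$) be the set of elements strictly smaller (resp. strictly larger) than $u$. An ordered pair $(u,v)$ of elements is a critical pair if $u$ and $v$ are incomparable, $\downarrow u\subseteq\downarrow v$ and $\uparrow v\subseteq\uparrow u$. -}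

module Defs where

open import Level using (Level)
open import Data.Nat using (ℕ; suc)
open import Data.Fin using (Fin; zero; fromℕ; toℕ)
open import Data.Product using (Σ; _×_; _,_)
open import Data.Sum using (_⊎_)
open import Relation.Nullary using (¬_)
open import Relation.Binary.PropositionalEquality using (_≡_; _≢_)
import Data.Nat as ℕ

module _ {a ℓ : Level} {A : Set a} (_<_ : A → A → Set ℓ) where

  Incomparable : A → A → Set _
  Incomparable u v = (u ≢ v) × (¬ (u < v)) × (¬ (v < u))

  DownSub : A → A → Set _
  DownSub u v = ∀ w → w < u → w < v

  UpSub : A → A → Set _
  UpSub v u = ∀ w → v < w → u < w

  CriticalPair : A → A → Set _
  CriticalPair u v = Incomparable u v × DownSub u v × UpSub v u

-- The blown-up poset P': element x of P (ground set Fin n) is replaced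
-- by a chain of length k(x) = suc (m x) ≥ 1; element x_i is (x , i)
-- with i : Fin (k x), where index zero is x_1 and fromℕ (m x) is x_{k(x)}.
module _ {n : ℕ} {ℓ : Level} (_<_ : Fin n → Fin n → Set ℓ) (m : Fin n → ℕ) where

  Blown : Set
  Blown = Σ (Fin n) (λ x → Fin (suc (m x)))

  _<′_ : Blown → Blown → Set ℓ
  (x , i) <′ (y , j) = Lift′ ((x ≡ y) × (toℕ i ℕ.< toℕ j)) ⊎ (x < y)
    where
      Lift′ : Set → Set ℓ
      Lift′ B = Level.Lift ℓ B

  first : Fin n → Blown
  first x = (x , zero)

  last : Fin n → Blown
  last y = (y , fromℕ (m y))

-- Inside a chain every two elements are comparable, so a critical pair (u , v) of P′ lies over two
-- distinct elements x, y of P.  Comparisons between different chains only see P, so (x , y) is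
-- critical in P.  Finally u is the bottom x₁ of its chain: otherwise x₁ < u, so x₁ < v since
-- ↓ u ⊆ ↓ v, i.e. x < y; dually v is the top y_{k(y)}.
module Submission where

open import Defs
open import Level using (Level; lift)
open import Data.Nat using (ℕ; suc; z<s)
import Data.Nat.Properties as ℕ
open import Data.Fin using (Fin; zero; suc; fromℕ) renaming (_<_ to _<ᶠ_)
open import Data.Fin.Properties using (≤fromℕ; ≤-antisym; <-cmp)
open import Data.Product using (Σ; _×_; _,_; proj₁; proj₂)
open import Data.Sum using (inj₁; inj₂)
open import Function using (_∘_)
open import Relation.Nullary using (¬_; contradiction)
open import Relation.Binary.Definitions using (tri<; tri≈; tri>)
open import Relation.Binary.PropositionalEquality using (_≡_; _≢_; refl; sym; cong; cong₂)
open import Relation.Binary.Structures using (IsStrictPartialOrder)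

fromℕ≮ : ∀ {k} (i : Fin (suc k)) → ¬ fromℕ k <ᶠ i
fromℕ≮ i = ℕ.≤⇒≯ (≤fromℕ i)

zero≮⇒≡zero : ∀ {k} (i : Fin (suc k)) → ¬ zero {k} <ᶠ i → i ≡ zero
zero≮⇒≡zero zero    _    = refl
zero≮⇒≡zero (suc i) 0≮1+i = contradiction z<s 0≮1+i

≮fromℕ⇒≡fromℕ : ∀ {k} (j : Fin (suc k)) → ¬ j <ᶠ fromℕ k → j ≡ fromℕ k
≮fromℕ⇒≡fromℕ j j≮top = ≤-antisym (≤fromℕ j) (ℕ.≮⇒≥ j≮top)

module Blowup {n : ℕ} {ℓ : Level} (_<_ : Fin n → Fin n → Set ℓ) (m : Fin n → ℕ) where

  _≺_ : Blown _<_ m → Blown _<_ m → Set ℓ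
  _≺_ = _<′_ _<_ m

  ≺-between-chains : ∀ {x y i j} → x ≢ y → (x , i) ≺ (y , j) → x < y
  ≺-between-chains x≢y (inj₁ (lift (x≡y , _))) = contradiction x≡y x≢y
  ≺-between-chains _   (inj₂ x<y)              = x<y

  ≺-first⇒< : ∀ {u x} → u ≺ first _<_ m x → proj₁ u < x
  ≺-first⇒< (inj₁ (lift (_ , ())))
  ≺-first⇒< (inj₂ p) = p

  last≺⇒< : ∀ {y v} → last _<_ m y ≺ v → y < proj₁ v
  last≺⇒< {y} {_ , j} (inj₁ (lift (refl , top<j))) = contradiction top<j (fromℕ≮ j)
  last≺⇒< (inj₂ y<z) = y<z

  chain-comparable : ∀ x (i j : Fin (suc (m x))) → ¬ Incomparable _≺_ (x , i) (x , j)
  chain-comparable x i j (i≢j , i⊀j , j⊀i) with <-cmp i j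
  ... | tri< i<j _ _ = i⊀j (inj₁ (lift (refl , i<j)))
  ... | tri≈ _ i≡j _ = i≢j (cong (x ,_) i≡j)
  ... | tri> _ _ j<i = j⊀i (inj₁ (lift (refl , j<i)))

  incomparable-lift : ∀ {x y} → Incomparable _<_ x y → ∀ i j → Incomparable _≺_ (x , i) (y , j)
  incomparable-lift (x≢y , x≮y , y≮x) i j =
    x≢y ∘ cong proj₁ , x≮y ∘ ≺-between-chains x≢y , y≮x ∘ ≺-between-chains (x≢y ∘ sym)

  incomparable-proj : ∀ {x y i j} → Incomparable _≺_ (x , i) (y , j) → Incomparable _<_ x y
  incomparable-proj {x} {y} {i} {j} inc@(_ , u⊀v , v⊀u) = x≢y , u⊀v ∘ inj₂ , v⊀u ∘ inj₂
    where
    x≢y : x ≢ y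
    x≢y refl = chain-comparable x i j inc

  criticalPair-first-last : ∀ {x y} → CriticalPair _<_ x y
    → CriticalPair _≺_ (first _<_ m x) (last _<_ m y)
  criticalPair-first-last {y = y} (inc , down , up) =
    incomparable-lift inc zero (fromℕ (m y)) ,
    (λ w w≺x₁ → inj₂ (down _ (≺-first⇒< w≺x₁))) ,
    (λ w yₖ≺w → inj₂ (up _ (last≺⇒< yₖ≺w)))

  first-last-injective : ∀ {x y x′ y′}
    → _≡_ {A = Blown _<_ m × Blown _<_ m} (first _<_ m x , last _<_ m y) (first _<_ m x′ , last _<_ m y′)
    → (x ≡ x′) × (y ≡ y′)
  first-last-injective e = cong (proj₁ ∘ proj₁) e , cong (proj₁ ∘ proj₂) e

  module _ {x y i j} (critical : CriticalPair _≺_ (x , i) (y , j)) where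

    private
      inc : Incomparable _<_ x y
      inc = incomparable-proj (proj₁ critical)

      down : DownSub _≺_ (x , i) (y , j)
      down = proj₁ (proj₂ critical)

      up : UpSub _≺_ (y , j) (x , i)
      up = proj₂ (proj₂ critical)

      x≢y : x ≢ y
      x≢y = proj₁ inc

      x≮y : ¬ x < y
      x≮y = proj₁ (proj₂ inc)

    criticalPair-proj : CriticalPair _<_ x y
    criticalPair-proj =
      inc ,
      (λ w w<x → last≺⇒< (down (last _<_ m w) (inj₂ w<x))) ,
      (λ w y<w → ≺-first⇒< (up (first _<_ m w) (inj₂ y<w)))

    critical-index-first : i ≡ zero
    critical-index-first = zero≮⇒≡zero i λ 0<i →
      x≮y (≺-between-chains x≢y (down (first _<_ m x) (inj₁ (lift (refl , 0<i)))))

    critical-index-last : j ≡ fromℕ (m y)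
    critical-index-last = ≮fromℕ⇒≡fromℕ j λ j<top →
      x≮y (≺-between-chains x≢y (up (last _<_ m y) (inj₁ (lift (refl , j<top)))))

  criticalPair-first-last⁻¹ : (u v : Blown _<_ m) → CriticalPair _≺_ u v
    → Σ (Fin n) (λ x → Σ (Fin n) (λ y →
        CriticalPair _<_ x y
        × _≡_ {A = Blown _<_ m × Blown _<_ m} (u , v) (first _<_ m x , last _<_ m y)))
  criticalPair-first-last⁻¹ (x , i) (y , j) critical =
    x , y , criticalPair-proj critical ,
    cong₂ (λ i j → (x , i) , (y , j)) (critical-index-first critical) (critical-index-last critical)

mainTheorem7 : {ℓ : Level} (n : ℕ) (_<_ : Fin n → Fin n → Set ℓ)
    → IsStrictPartialOrder _≡_ _<_
    → (m : Fin n → ℕ)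
    → ((x y : Fin n) → CriticalPair _<_ x y
         → CriticalPair (_<′_ _<_ m) (first _<_ m x) (last _<_ m y))
      × ((x y x′ y′ : Fin n) → CriticalPair _<_ x y → CriticalPair _<_ x′ y′
         → _≡_ {A = Blown _<_ m × Blown _<_ m}
             (first _<_ m x , last _<_ m y) (first _<_ m x′ , last _<_ m y′)
         → (x ≡ x′) × (y ≡ y′))
      × ((u v : Blown _<_ m) → CriticalPair (_<′_ _<_ m) u v
         → Σ (Fin n) (λ x → Σ (Fin n) (λ y →
             CriticalPair _<_ x y
             × _≡_ {A = Blown _<_ m × Blown _<_ m}
               (u , v) (first _<_ m x , last _<_ m y))))
mainTheorem7 n _<_ _ m =
  (λ _ _ → criticalPair-first-last) ,
  (λ _ _ _ _ _ _ → first-last-injective) ,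
  criticalPair-first-last⁻¹
  where open Blowup _<_ m
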